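{- For a finite sequence $\mathbf{K}$ of natural numbers let $$\tilde{C}_{\mathbf{K}}(q,t)=\sum_{P:\ \mathrm{Pr}(P)=\mathbf{K}} q^{\mathrm{area}(P)}\,t^{\mathrm{depth}(P)},$$ the sum being over all Łukasiewicz paths $P$ with profile $\mathbf{K}$. Then, for every finite sequence $\mathbf{K}$ of natural numbers: (1) $\tilde{C}_{\mathbf{K}\cdot(a)}(q,t)=\tilde{C}_{\mathbf{K}\cdot(b)}(q,t)$ for all $a,b\in\mathbb{N}$, where $\mathbf{K}\cdot(a)$ denotes the sequence $\mathbf{K}$ with $a$ appended at the end; (2) if $\mathbf{K}$ has length $3$, then $\tilde{C}_{\mathbf{K}}(q,t)=\tilde{C}_{\mathbf{K}}(t,q)$.
   Context: A Łukasiewicz path is a finite lattice path in $\mathbb{Z}^2$ starting at $(0,0)$, using steps $(1,k)$ with $k\ge -1$, such that every point except the final endpoint has nonnegative $y$-coordinate and the last step is $(1,-1)$. Write $D=(1,-1)$ and $U_k=(1,k)$ for $k\ge0$ (up-step of degree $k$). The profile $\mathrm{Pr}(P)$ is the sequence of degrees of the up-steps of $P$ from left to right. Write $P=P_1\cdots P_n$. $\mathrm{area}(P)$ is the sum, over all up-steps, of the $y$-coordinate of the starting point of the up-step. Depth: each down-step $P_j=D$ other than the last goes from height $h+1$ to $h$ ($h\ge0$); it is matched with the up-step $P_i=U_k$ ($k>0$) with largest index $i<j$ whose starting height $y$ satisfies $y\le h<y+k$. Each $U_k$ is matched with exactly $k$ down-steps $P_{j_1},\dots,P_{j_k}$, $j_1<\dots<j_k$,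 and $P_{j_\ell}$ is its $\ell$-th matching down-step. Define $d_i$: if $P_1$ is an up-step, $d_1=0$; if $P_i=D$ is the $\ell$-th matching down-step of the up-step $P_j$, $d_i=d_j+\ell$; if $P_i$ is an up-step with $i>1$, $d_i=d_{i-1}$. $\mathrm{depth}(P)$ is the sum of $d_i$ over all $i$ with $P_i$ an up-step. -}

module Defs where

open import Data.Nat using (ℕ; zero; suc; _+_; _∸_; _≤ᵇ_; _<ᵇ_; _≡ᵇ_)
open import Data.Bool using (Bool; true; false; _∧_; if_then_else_)
open import Data.List using (List; []; _∷_; _++_; map; filter; length; replicate; reverse)
open import Data.Nat.ListAction using (sum)
open import Data.Maybe using (Maybe; just; nothing)
open import Data.Product using (_×_; _,_; proj₁; proj₂)
open import Relation.Nullary.Decidable using (Dec; yes; no)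
open import Data.Bool.Properties using (T?)

-- Steps: D = (1,-1), U k = (1,k) for k ≥ 0.

data Step : Set where
  D : Step
  U : ℕ → Step

isUp : Step → Bool
isUp D     = false
isUp (U _) = true

profile : List Step → List ℕ
profile []          = []
profile (D   ∷ ps)  = profile ps
profile (U k ∷ ps)  = k ∷ profile ps

-- Łukasiewicz condition, checked from current height h ≥ 0.
-- Every point except the final endpoint has y ≥ 0, the last step is D,
-- and the final endpoint is at height -1 (i.e. the last step starts at 0).

lukFrom : ℕ → List Step → Bool
lukFrom h []               = false
lukFrom h (D ∷ [])         = h ≡ᵇ 0
lukFrom zero    (D ∷ _ ∷ _)    = false
lukFrom (suc h) (D ∷ s ∷ ps)   = lukFrom h (s ∷ ps)
lukFrom h (U k ∷ ps)       = lukFrom (h + k) ps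

isLuk : List Step → Bool
isLuk = lukFrom 0

-- Candidate words with a given profile: all interleavings of the list of
-- up-steps (in order) with n down-steps.  Each word appears once.

shuffle : List Step → ℕ → List (List Step)
shuffle []       n       = replicate n D ∷ []
shuffle (u ∷ us) zero    = (u ∷ us) ∷ []
shuffle (u ∷ us) (suc n) =
  map (u ∷_) (shuffle us (suc n)) ++ map (D ∷_) (shuffle (u ∷ us) n)

-- All Łukasiewicz paths with profile K.  Such a path has exactly
-- (sum K + 1) down-steps, since it goes from height 0 to height -1.
lukPaths : List ℕ → List (List Step)
lukPaths K = filter (λ P → T? (isLuk P)) (shuffle (map U K) (suc (sum K)))

-- Step-by-step information: the step, its index i (0-based), the height y
-- of its starting point, the value d_i, and (for non-final down-steps)
-- the index of the matched up-step.

record Info : Set where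
  constructor info
  field
    step  : Step
    index : ℕ
    y     : ℕ
    dval  : ℕ
    match : Maybe ℕ
open Info public

maybeEq : Maybe ℕ → ℕ → Bool
maybeEq (just a) b = a ≡ᵇ b
maybeEq nothing  b = false

covers : ℕ → Info → Bool
covers h (info D _ _ _ _)     = false
covers h (info (U k) _ y _ _) = (0 <ᵇ k) ∧ (y ≤ᵇ h) ∧ (h <ᵇ y + k)

firstWhere : (Info → Bool) → List Info → Maybe Info
firstWhere p []       = nothing
firstWhere p (x ∷ xs) = if p x then just x else firstWhere p xs

countMatched : ℕ → List Info → ℕ
countMatched i []       = 0
countMatched i (x ∷ xs) = (if maybeEq (match x) i then 1 else 0) + countMatched i xs

heightAfter : Step → ℕ → ℕ
heightAfter D     y = y ∸ 1
heightAfter (U k) y = y + k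

-- Process the path left to right.  `prev` is the list of Infos of the
-- steps already processed, in order; `j` the index of the next step,
-- `h` its starting height.
process : List Info → ℕ → ℕ → List Step → List Info
process prev j h []       = prev
process prev j h (U k ∷ ps) =
  let d = dPrev prev in
  process (prev ++ info (U k) j h d nothing ∷ []) (suc j) (h + k) ps
  where
    -- d_1 = 0 for the first step; otherwise d_j = d_{j-1}
    dPrev : List Info → ℕ
    dPrev xs with reverse xs
    ... | []      = 0
    ... | (x ∷ _) = dval x
-- the last step (a down-step): d is not used, no matching
process prev j h (D ∷ []) = prev ++ info D j h 0 nothing ∷ []
process prev j h (D ∷ p ∷ ps) =
  process (prev ++ downInfo (firstWhere (covers (h ∸ 1)) (reverse prev)) ∷ [])
          (suc j) (h ∸ 1) (p ∷ ps)
  where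
    downInfo : Maybe Info → Info
    downInfo nothing  = info D j h 0 nothing
    downInfo (just m) =
      info D j h (dval m + suc (countMatched (index m) prev)) (just (index m))

infos : List Step → List Info
infos P = process [] 0 0 P

upInfos : List Step → List Info
upInfos P = filter (λ x → T? (isUp (step x))) (infos P)

area : List Step → ℕ
area P = sum (map y (upInfos P))

depth : List Step → ℕ
depth P = sum (map dval (upInfos P))

-- C̃_K(q,t) = Σ_{Pr(P)=K} q^area(P) t^depth(P), represented by its
-- coefficients: Ctilde K i j = coefficient of q^i t^j
--   = number of Łukasiewicz paths with profile K, area i, depth j.

Ctilde : List ℕ → ℕ → ℕ → ℕ
Ctilde K i j =
  length (filter (λ P → T? ((area P ≡ᵇ i) ∧ (depth P ≡ᵇ j))) (lukPaths K))

{-# OPTIONS --safe #-}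
module Submission where

-- The degree a of the last up-step only fixes the length h + a + 1 of the final
-- descent: it changes neither the starting height h of that step, nor its d-value
-- (that of the preceding step), nor anything earlier in the path. This gives (1).
-- By (1), for (2) the profile may be taken to be (k₁, k₂, 0); the paths are then
-- U k₁ Dʳ U k₂ Dˢ U₀ D^(c+1), c being the height of the last up-step.
-- If s ≤ k₂, all of Dˢ is matched with U k₂, and area and depth are
-- (k₁−r) + (k₁−r + k₂−s) and r + (r+s), exchanged by (r, s) ↦ (k₁−r, k₂−s).
-- Otherwise Dˢ descends below the start of U k₂ to c < k₁−r, its last steps being
-- matched with U k₁; area and depth are (k₁−r) + c and (k₁−c) + r, exchanged by r ↔ c.

open import Defs
open import Data.Nat using (ℕ; zero; suc; _+_; _∸_; _≡ᵇ_; _≤ᵇ_; _<ᵇ_; _≤_; _<_; z≤n; s≤s; z<s; s<s; s≤s⁻¹)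
open import Data.Nat.Properties
open import Algebra.Properties.CommutativeSemigroup +-commutativeSemigroup using (interchange)
open import Data.Bool using (Bool; true; false; _∧_; if_then_else_; T)
open import Data.Unit using (tt)
open import Relation.Nullary.Negation using (contradiction)
open import Relation.Nullary.Decidable using (Dec)
open import Data.Bool.Properties using (T?; ∧-comm; ∧-zeroʳ; T-≡)
open import Data.List using (List; []; _∷_; _++_; [_]; length; map; filter; replicate; reverse)
open import Data.List.Properties using (length-++; filter-++; map-++; reverse-++; ++-assoc; ++-identityʳ)
open import Data.Nat.ListAction using (sum)
open import Data.Nat.ListAction.Properties using (sum-++)
open import Data.Maybe using (just; nothing)
open import Data.Product using (_×_; _,_)
open import Relation.Binary.PropositionalEquality hiding ([_])
open import Function.Bundles using (Equivalence)
open ≡-Reasoning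

indicator : Bool → ℕ
indicator true  = 1
indicator false = 0

-- Finite sums

∑< : ℕ → (ℕ → ℕ) → ℕ
∑< zero    f = 0
∑< (suc n) f = f 0 + ∑< n (λ x → f (suc x))

syntax ∑< n (λ x → e) = ∑[ x < n ] e

∑-cong : ∀ n {f g} → (∀ x → x < n → f x ≡ g x) → ∑< n f ≡ ∑< n g
∑-cong zero    f≗g = refl
∑-cong (suc n) f≗g = cong₂ _+_ (f≗g 0 z<s) (∑-cong n (λ x x<n → f≗g (suc x) (s<s x<n)))

∑-zero : ∀ n {f} → (∀ x → x < n → f x ≡ 0) → ∑< n f ≡ 0
∑-zero zero    f≗0 = refl
∑-zero (suc n) f≗0 = cong₂ _+_ (f≗0 0 z<s) (∑-zero n (λ x x<n → f≗0 (suc x) (s<s x<n)))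

∑-+ : ∀ m n (f : ℕ → ℕ) → ∑< (m + n) f ≡ ∑< m f + ∑[ x < n ] f (m + x)
∑-+ zero    n f = refl
∑-+ (suc m) n f = trans (cong (f 0 +_) (∑-+ m n (λ x → f (suc x)))) (sym (+-assoc (f 0) _ _))

∑-last : ∀ n (f : ℕ → ℕ) → ∑< (suc n) f ≡ ∑< n f + f n
∑-last n f = begin
  ∑< (suc n) f                 ≡⟨ cong (λ m → ∑< m f) (+-comm 1 n) ⟩
  ∑< (n + 1) f                 ≡⟨ ∑-+ n 1 f ⟩
  ∑< n f + (f (n + 0) + 0)     ≡⟨ cong (∑< n f +_) (trans (+-identityʳ _) (cong f (+-identityʳ n))) ⟩
  ∑< n f + f n                 ∎

∑-distrib : ∀ n (f g : ℕ → ℕ) → ∑[ x < n ] (f x + g x) ≡ ∑< n f + ∑< n g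
∑-distrib zero    f g = refl
∑-distrib (suc n) f g = trans (cong (f 0 + g 0 +_) (∑-distrib n (λ x → f (suc x)) (λ x → g (suc x))))
                              (interchange (f 0) (g 0) _ _)

∑-reverse : ∀ n (f : ℕ → ℕ) → ∑< n f ≡ ∑[ x < n ] f (n ∸ suc x)
∑-reverse zero    f = refl
∑-reverse (suc n) f = begin
  f 0 + ∑[ x < n ] f (suc x)               ≡⟨ cong (f 0 +_) (∑-reverse n (λ x → f (suc x))) ⟩
  f 0 + ∑[ x < n ] f (suc (n ∸ suc x))     ≡⟨ +-comm (f 0) _ ⟩
  ∑[ x < n ] f (suc (n ∸ suc x)) + f 0
    ≡⟨ cong₂ _+_ (∑-cong n λ x x<n → cong f (sym (+-∸-assoc 1 x<n))) (cong f (sym (n∸n≡0 n))) ⟩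
  ∑[ x < n ] f (n ∸ x) + f (n ∸ n)         ≡⟨ ∑-last n (λ x → f (n ∸ x)) ⟨
  ∑[ x < suc n ] f (suc n ∸ suc x)         ∎

-- ∑[ r < suc n ] ∑< (n ∸ r) (F r) is the sum of F over the pairs (r , c) with r + c < n.
∑-triangle-firstColumn : ∀ n (F : ℕ → ℕ → ℕ) →
  ∑[ r < suc (suc n) ] ∑< (suc n ∸ r) (F r)
  ≡ ∑[ r < suc n ] F r 0 + ∑[ r < suc n ] ∑[ c < n ∸ r ] F r (suc c)
∑-triangle-firstColumn n F = begin
  ∑[ r < suc (suc n) ] ∑< (suc n ∸ r) (F r)
    ≡⟨ ∑-last (suc n) (λ r → ∑< (suc n ∸ r) (F r)) ⟩
  ∑[ r < suc n ] ∑< (suc n ∸ r) (F r) + ∑< (n ∸ n) (F (suc n))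
    ≡⟨ cong₂ _+_ (∑-cong (suc n) λ r r<1+n → cong (λ m → ∑< m (F r)) (+-∸-assoc 1 (s≤s⁻¹ r<1+n)))
                 (cong (λ m → ∑< m (F (suc n))) (n∸n≡0 n)) ⟩
  ∑[ r < suc n ] ∑< (suc (n ∸ r)) (F r) + 0
    ≡⟨ +-identityʳ _ ⟩
  ∑[ r < suc n ] (F r 0 + ∑[ c < n ∸ r ] F r (suc c))
    ≡⟨ ∑-distrib (suc n) (λ r → F r 0) (λ r → ∑[ c < n ∸ r ] F r (suc c)) ⟩
  ∑[ r < suc n ] F r 0 + ∑[ r < suc n ] ∑[ c < n ∸ r ] F r (suc c) ∎

∑-triangle-transpose : ∀ n (F : ℕ → ℕ → ℕ) → ∑[ r < suc n ] ∑< (n ∸ r) (F r) ≡ ∑[ r < suc n ] ∑[ c < n ∸ r ] F c r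
∑-triangle-transpose zero    F = refl
∑-triangle-transpose (suc n) F = begin
  ∑[ c < suc n ] F 0 c + ∑[ r < suc n ] ∑< (n ∸ r) (F (suc r))
    ≡⟨ cong (∑[ c < suc n ] F 0 c +_) (∑-triangle-transpose n (λ r → F (suc r))) ⟩
  ∑[ c < suc n ] F 0 c + ∑[ r < suc n ] ∑[ c < n ∸ r ] F (suc c) r
    ≡⟨ ∑-triangle-firstColumn n (λ r c → F c r) ⟨
  ∑[ r < suc (suc n) ] ∑[ c < suc n ∸ r ] F c r ∎

-- Counting interleavings

countWhere : (List Step → Bool) → List (List Step) → ℕ
countWhere p ws = length (filter (λ w → T? (p w)) ws)

countWhere-++ : ∀ p ws vs → countWhere p (ws ++ vs) ≡ countWhere p ws + countWhere p vs
countWhere-++ p ws vs = trans (cong length (filter-++ _ ws vs)) (length-++ (filter _ ws))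

countWhere-map : ∀ p (f : List Step → List Step) ws → countWhere p (map f ws) ≡ countWhere (λ w → p (f w)) ws
countWhere-map p f []       = refl
countWhere-map p f (w ∷ ws) with p (f w)
... | true  = cong suc (countWhere-map p f ws)
... | false = countWhere-map p f ws

countWhere-[] : ∀ p w → countWhere p [ w ] ≡ indicator (p w)
countWhere-[] p w with p w
... | true  = refl
... | false = refl

countWhere-filter : ∀ (p q : List Step → Bool) ws →
  length (filter (λ w → T? (p w)) (filter (λ w → T? (q w)) ws)) ≡ countWhere (λ w → q w ∧ p w) ws
countWhere-filter p q []       = refl
countWhere-filter p q (w ∷ ws) with q w
... | false = countWhere-filter p q ws
... | true with p w
... | true  = cong suc (countWhere-filter p q ws)
... | false = countWhere-filter p q ws

shuffleCount : (List Step → Bool) → List Step → ℕ → ℕ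
shuffleCount p []       n       = indicator (p (replicate n D))
shuffleCount p (u ∷ us) zero    = indicator (p (u ∷ us))
shuffleCount p (u ∷ us) (suc n) =
  shuffleCount (λ w → p (u ∷ w)) us (suc n) + shuffleCount (λ w → p (D ∷ w)) (u ∷ us) n

countWhere-shuffle : ∀ p us n → countWhere p (shuffle us n) ≡ shuffleCount p us n
countWhere-shuffle p []       n       = countWhere-[] p _
countWhere-shuffle p (u ∷ us) zero    = countWhere-[] p _
countWhere-shuffle p (u ∷ us) (suc n) = begin
  countWhere p (map (u ∷_) (shuffle us (suc n)) ++ map (D ∷_) (shuffle (u ∷ us) n))
    ≡⟨ countWhere-++ p (map (u ∷_) (shuffle us (suc n))) _ ⟩
  countWhere p (map (u ∷_) (shuffle us (suc n))) + countWhere p (map (D ∷_) (shuffle (u ∷ us) n))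
    ≡⟨ cong₂ _+_ (countWhere-map p (u ∷_) (shuffle us (suc n))) (countWhere-map p (D ∷_) (shuffle (u ∷ us) n)) ⟩
  countWhere (λ w → p (u ∷ w)) (shuffle us (suc n)) + countWhere (λ w → p (D ∷ w)) (shuffle (u ∷ us) n)
    ≡⟨ cong₂ _+_ (countWhere-shuffle _ us (suc n)) (countWhere-shuffle _ (u ∷ us) n) ⟩
  shuffleCount p (u ∷ us) (suc n) ∎

shuffleCount-cong : ∀ {p q} us n → (∀ w → p w ≡ q w) → shuffleCount p us n ≡ shuffleCount q us n
shuffleCount-cong []       n       p≗q = cong indicator (p≗q _)
shuffleCount-cong (u ∷ us) zero    p≗q = cong indicator (p≗q _)
shuffleCount-cong (u ∷ us) (suc n) p≗q =
  cong₂ _+_ (shuffleCount-cong us (suc n) (λ w → p≗q (u ∷ w)))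
            (shuffleCount-cong (u ∷ us) n (λ w → p≗q (D ∷ w)))

shuffleCount-false : ∀ us n → shuffleCount (λ _ → false) us n ≡ 0
shuffleCount-false []       n       = refl
shuffleCount-false (u ∷ us) zero    = refl
shuffleCount-false (u ∷ us) (suc n) = cong₂ _+_ (shuffleCount-false us (suc n)) (shuffleCount-false (u ∷ us) n)

-- All interleavings of a nonempty word are nonempty.
shuffleCount-∷-none : ∀ {p} u us n → (∀ x w → p (x ∷ w) ≡ false) → shuffleCount p (u ∷ us) n ≡ 0
shuffleCount-∷-none u us zero    p≡false = cong indicator (p≡false u us)
shuffleCount-∷-none u us (suc n) p≡false =
  cong₂ _+_ (trans (shuffleCount-cong us (suc n) (p≡false u)) (shuffleCount-false us (suc n)))
            (trans (shuffleCount-cong (u ∷ us) n (p≡false D)) (shuffleCount-false (u ∷ us) n))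

shuffleCount-∷ : ∀ p u us n →
  shuffleCount p (u ∷ us) n ≡ ∑[ r < suc n ] shuffleCount (λ w → p (replicate r D ++ u ∷ w)) us (n ∸ r)
shuffleCount-∷ p u []         zero    = sym (+-identityʳ _)
shuffleCount-∷ p u (u′ ∷ us)  zero    = sym (+-identityʳ _)
shuffleCount-∷ p u us         (suc n) =
  cong (shuffleCount (λ w → p (u ∷ w)) us (suc n) +_) (shuffleCount-∷ (λ w → p (D ∷ w)) u us n)

-- Scanning a path with Defs.process

isUp? : (x : Info) → Dec (T (isUp (step x)))
isUp? x = T? (isUp (step x))

upSteps : List Info → List Info
upSteps = filter isUp?

upSum : (Info → ℕ) → List Info → ℕ
upSum f L = sum (map f (upSteps L))

upSum-++ : ∀ f L M → upSum f (L ++ M) ≡ upSum f L + upSum f M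
upSum-++ f L M = begin
  sum (map f (upSteps (L ++ M)))                  ≡⟨ cong (λ xs → sum (map f xs)) (filter-++ _ L M) ⟩
  sum (map f (upSteps L ++ upSteps M))            ≡⟨ cong sum (map-++ f (upSteps L) (upSteps M)) ⟩
  sum (map f (upSteps L) ++ map f (upSteps M))    ≡⟨ sum-++ (map f (upSteps L)) _ ⟩
  upSum f L + upSum f M                           ∎

statsAre : ℕ → ℕ → ℕ → ℕ → Bool
statsAre i j a d = (a ≡ᵇ i) ∧ (d ≡ᵇ j)

statsAre-swap : ∀ i j a d → statsAre i j a d ≡ statsAre j i d a
statsAre-swap i j a d = ∧-comm (a ≡ᵇ i) (d ≡ᵇ j)

-- prev, k and h are the state of Defs.process: the Infos so far, the next index and the height.
accepts : ℕ → ℕ → List Info → ℕ → ℕ → List Step → Bool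
accepts i j prev k h w =
  lukFrom h w ∧ statsAre i j (upSum y (process prev k h w)) (upSum dval (process prev k h w))

Ctilde≡shuffleCount : ∀ K i j → Ctilde K i j ≡ shuffleCount (accepts i j [] 0 0) (map U K) (suc (sum K))
Ctilde≡shuffleCount K i j = trans (countWhere-filter _ isLuk (shuffle (map U K) (suc (sum K))))
                                  (countWhere-shuffle _ (map U K) (suc (sum K)))

-- lastDval and downInfo restate the local helpers of Defs.process, so that process-U and
-- process-D hold by computation.
lastDval : List Info → ℕ
lastDval xs with reverse xs
... | []    = 0
... | x ∷ _ = dval x

lastDval-∷ʳ : ∀ L x → lastDval (L ++ [ x ]) ≡ dval x
lastDval-∷ʳ L x rewrite reverse-++ L [ x ] = refl

downInfo : List Info → ℕ → ℕ → Info
downInfo prev k h with firstWhere (covers (h ∸ 1)) (reverse prev)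
... | nothing = info D k h 0 nothing
... | just m  = info D k h (dval m + suc (countMatched (index m) prev)) (just (index m))

downInfo-matched : ∀ prev k h m → firstWhere (covers (h ∸ 1)) (reverse prev) ≡ just m →
  downInfo prev k h ≡ info D k h (dval m + suc (countMatched (index m) prev)) (just (index m))
downInfo-matched prev k h m found with firstWhere (covers (h ∸ 1)) (reverse prev)
downInfo-matched prev k h m refl | just .m = refl

upSteps-downInfo : ∀ prev k h → upSteps [ downInfo prev k h ] ≡ []
upSteps-downInfo prev k h with firstWhere (covers (h ∸ 1)) (reverse prev)
... | nothing = refl
... | just _  = refl

process-U : ∀ prev k h a w →
  process prev k h (U a ∷ w) ≡ process (prev ++ [ info (U a) k h (lastDval prev) nothing ]) (suc k) (h + a) w
process-U prev k h a w with reverse prev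
... | []    = refl
... | _ ∷ _ = refl

process-D : ∀ prev k h x w →
  process prev k h (D ∷ x ∷ w) ≡ process (prev ++ [ downInfo prev k h ]) (suc k) (h ∸ 1) (x ∷ w)
process-D prev k h x w with firstWhere (covers (h ∸ 1)) (reverse prev)
... | nothing = refl
... | just _  = refl

-- The Infos of n down-steps from index k and height h, all matched with m after c earlier matches.
matchedDowns : Info → ℕ → ℕ → ℕ → ℕ → List Info
matchedDowns m c k h zero    = []
matchedDowns m c k h (suc n) = info D k h (dval m + suc c) (just (index m)) ∷ matchedDowns m (suc c) (suc k) (h ∸ 1) n

upSteps-matchedDowns : ∀ m c k h n → upSteps (matchedDowns m c k h n) ≡ []
upSteps-matchedDowns m c k h zero    = refl
upSteps-matchedDowns m c k h (suc n) = upSteps-matchedDowns m (suc c) (suc k) (h ∸ 1) n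

lastDval-matchedDowns : ∀ L m c k h n → lastDval (L ++ matchedDowns m c k h (suc n)) ≡ dval m + suc (c + n)
lastDval-matchedDowns L m c k h zero    = trans (lastDval-∷ʳ L _) (cong (λ e → dval m + suc e) (sym (+-identityʳ c)))
lastDval-matchedDowns L m c k h (suc n) = begin
  lastDval (L ++ x ∷ matchedDowns m (suc c) (suc k) (h ∸ 1) (suc n))    ≡⟨ cong lastDval (++-assoc L [ x ] _) ⟨
  lastDval ((L ++ [ x ]) ++ matchedDowns m (suc c) (suc k) (h ∸ 1) (suc n))
    ≡⟨ lastDval-matchedDowns (L ++ [ x ]) m (suc c) (suc k) (h ∸ 1) n ⟩
  dval m + suc (suc c + n)                                              ≡⟨ cong (λ e → dval m + suc e) (+-suc c n) ⟨
  dval m + suc (c + suc n)                                              ∎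
  where x = info D k h (dval m + suc c) (just (index m))

firstWhere-∷ʳ : ∀ p L z → firstWhere p (reverse (L ++ [ z ])) ≡ (if p z then just z else firstWhere p (reverse L))
firstWhere-∷ʳ p L z rewrite reverse-++ L [ z ] = refl

firstWhere-covers-matchedDowns : ∀ ℓ L m c k h n →
  firstWhere (covers ℓ) (reverse (L ++ matchedDowns m c k h n)) ≡ firstWhere (covers ℓ) (reverse L)
firstWhere-covers-matchedDowns ℓ L m c k h zero    = cong (λ M → firstWhere (covers ℓ) (reverse M)) (++-identityʳ L)
firstWhere-covers-matchedDowns ℓ L m c k h (suc n) = begin
  firstWhere (covers ℓ) (reverse (L ++ x ∷ matchedDowns m (suc c) (suc k) (h ∸ 1) n))
    ≡⟨ cong (λ M → firstWhere (covers ℓ) (reverse M)) (++-assoc L [ x ] _) ⟨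
  firstWhere (covers ℓ) (reverse ((L ++ [ x ]) ++ matchedDowns m (suc c) (suc k) (h ∸ 1) n))
    ≡⟨ firstWhere-covers-matchedDowns ℓ (L ++ [ x ]) m (suc c) (suc k) (h ∸ 1) n ⟩
  firstWhere (covers ℓ) (reverse (L ++ [ x ]))
    ≡⟨ firstWhere-∷ʳ (covers ℓ) L x ⟩
  firstWhere (covers ℓ) (reverse L) ∎
  where x = info D k h (dval m + suc c) (just (index m))

countMatched-++ : ∀ i xs ys → countMatched i (xs ++ ys) ≡ countMatched i xs + countMatched i ys
countMatched-++ i []       ys = refl
countMatched-++ i (x ∷ xs) ys =
  trans (cong (_ +_) (countMatched-++ i xs ys)) (sym (+-assoc (if maybeEq (match x) i then 1 else 0) _ _))

≡ᵇ-refl : ∀ n → (n ≡ᵇ n) ≡ true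
≡ᵇ-refl n = Equivalence.to T-≡ (≡⇒≡ᵇ n n refl)

countMatched-matchedDowns : ∀ m c k h n → countMatched (index m) (matchedDowns m c k h n) ≡ n
countMatched-matchedDowns m c k h zero = refl
countMatched-matchedDowns m c k h (suc n) rewrite ≡ᵇ-refl (index m) =
  cong suc (countMatched-matchedDowns m (suc c) (suc k) (h ∸ 1) n)

countMatched-matchedDowns-other : ∀ i m c k h n → (index m ≡ᵇ i) ≡ false → countMatched i (matchedDowns m c k h n) ≡ 0
countMatched-matchedDowns-other i m c k h zero    _     = refl
countMatched-matchedDowns-other i m c k h (suc n) other rewrite other =
  countMatched-matchedDowns-other i m (suc c) (suc k) (h ∸ 1) n other

upSteps-finalDescent : ∀ t prev k h → upSteps (process prev k h (replicate (suc t) D)) ≡ upSteps prev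
upSteps-finalDescent zero    prev k h = trans (filter-++ _ prev _) (++-identityʳ (upSteps prev))
upSteps-finalDescent (suc t) prev k h = begin
  upSteps (process prev k h (D ∷ D ∷ replicate t D))
    ≡⟨ cong upSteps (process-D prev k h D (replicate t D)) ⟩
  upSteps (process (prev ++ [ downInfo prev k h ]) (suc k) (h ∸ 1) (replicate (suc t) D))
    ≡⟨ upSteps-finalDescent t (prev ++ [ downInfo prev k h ]) (suc k) (h ∸ 1) ⟩
  upSteps (prev ++ [ downInfo prev k h ])                                          ≡⟨ filter-++ _ prev _ ⟩
  upSteps prev ++ upSteps [ downInfo prev k h ]                                    ≡⟨ cong (upSteps prev ++_) (upSteps-downInfo prev k h) ⟩
  upSteps prev ++ []                                                               ≡⟨ ++-identityʳ (upSteps prev) ⟩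
  upSteps prev                                                                     ∎

lukFrom-finalDescent : ∀ h → lukFrom h (replicate (suc h) D) ≡ true
lukFrom-finalDescent zero    = refl
lukFrom-finalDescent (suc h) = lukFrom-finalDescent h

lukFrom-overDescent : ∀ n h x w → h < n → lukFrom h (replicate n D ++ x ∷ w) ≡ false
lukFrom-overDescent (suc zero)    zero    x w _         = refl
lukFrom-overDescent (suc (suc n)) zero    x w _         = refl
lukFrom-overDescent (suc zero)    (suc h) x w (s<s ())
lukFrom-overDescent (suc (suc n)) (suc h) x w (s<s h<n) = lukFrom-overDescent (suc n) h x w h<n

upSum-∷ʳ-up : ∀ f L a k h d → upSum f (L ++ [ info (U a) k h d nothing ]) ≡ upSum f L + f (info (U a) k h d nothing)
upSum-∷ʳ-up f L a k h d = trans (upSum-++ f L _) (cong (upSum f L +_) (+-identityʳ _))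

upSum-++-matchedDowns : ∀ f L m c k h n → upSum f (L ++ matchedDowns m c k h n) ≡ upSum f L
upSum-++-matchedDowns f L m c k h n = begin
  upSum f (L ++ matchedDowns m c k h n)          ≡⟨ upSum-++ f L _ ⟩
  upSum f L + sum (map f (upSteps (matchedDowns m c k h n)))
    ≡⟨ cong (λ M → upSum f L + sum (map f M)) (upSteps-matchedDowns m c k h n) ⟩
  upSum f L + 0                                  ≡⟨ +-identityʳ _ ⟩
  upSum f L                                      ∎

module _ (i j : ℕ) where

  accepts-U : ∀ prev k h a w →
    accepts i j prev k h (U a ∷ w) ≡ accepts i j (prev ++ [ info (U a) k h (lastDval prev) nothing ]) (suc k) (h + a) w
  accepts-U prev k h a w rewrite process-U prev k h a w = refl

  -- Also for w = [], where both sides fail the Łukasiewicz condition.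
  accepts-D : ∀ prev k h w →
    accepts i j prev k (suc h) (D ∷ w) ≡ accepts i j (prev ++ [ downInfo prev k (suc h) ]) (suc k) h w
  accepts-D prev k h []      = refl
  accepts-D prev k h (x ∷ w) rewrite process-D prev k (suc h) x w = refl

  accepts-matchedRun : ∀ n prev k h m c w → n ≤ h →
    (∀ l → l < n → firstWhere (covers (h ∸ suc l)) (reverse prev) ≡ just m) →
    countMatched (index m) prev ≡ c →
    accepts i j prev k h (replicate n D ++ w) ≡ accepts i j (prev ++ matchedDowns m c k h n) (k + n) (h ∸ n) w
  accepts-matchedRun zero prev k h m c w _ _ _ rewrite ++-identityʳ prev | +-identityʳ k = refl
  accepts-matchedRun (suc n) prev k (suc h) m c w (s≤s n≤h) found counted = begin
    accepts i j prev k (suc h) (D ∷ replicate n D ++ w)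
      ≡⟨ accepts-D prev k h (replicate n D ++ w) ⟩
    accepts i j (prev ++ [ downInfo prev k (suc h) ]) (suc k) h (replicate n D ++ w)
      ≡⟨ cong (λ x → accepts i j (prev ++ [ x ]) (suc k) h (replicate n D ++ w))
              (trans (downInfo-matched prev k (suc h) m (found 0 z<s)) (cong (λ e → info D k (suc h) (dval m + suc e) _) counted)) ⟩
    accepts i j (prev ++ [ x ]) (suc k) h (replicate n D ++ w)
      ≡⟨ accepts-matchedRun n (prev ++ [ x ]) (suc k) h m (suc c) w n≤h found′ counted′ ⟩
    accepts i j ((prev ++ [ x ]) ++ matchedDowns m (suc c) (suc k) h n) (suc k + n) (h ∸ n) w
      ≡⟨ cong₂ (λ L k′ → accepts i j L k′ (h ∸ n) w) (++-assoc prev [ x ] _) (sym (+-suc k n)) ⟩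
    accepts i j (prev ++ matchedDowns m c k (suc h) (suc n)) (k + suc n) (h ∸ n) w ∎
    where
    x = info D k (suc h) (dval m + suc c) (just (index m))
    found′ : ∀ l → l < n → firstWhere (covers (h ∸ suc l)) (reverse (prev ++ [ x ])) ≡ just m
    found′ l l<n = trans (firstWhere-∷ʳ (covers (h ∸ suc l)) prev x) (found (suc l) (s<s l<n))
    counted′ : countMatched (index m) (prev ++ [ x ]) ≡ suc c
    counted′ rewrite countMatched-++ (index m) prev [ x ] | counted
                   | ≡ᵇ-refl (index m) = +-comm c 1

  accepts-overDescent : ∀ n prev k h x w → h < n → accepts i j prev k h (replicate n D ++ x ∷ w) ≡ false
  accepts-overDescent n prev k h x w h<n =
    cong (_∧ statsAre i j (upSum y (process prev k h v)) (upSum dval (process prev k h v))) (lukFrom-overDescent n h x w h<n)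
    where v = replicate n D ++ x ∷ w

  accepts-lastUp : ∀ prev k h a t → t ≡ h + a →
    accepts i j prev k h (U a ∷ replicate (suc t) D) ≡ statsAre i j (upSum y prev + h) (upSum dval prev + lastDval prev)
  accepts-lastUp prev k h a _ refl = begin
    accepts i j prev k h (U a ∷ replicate (suc (h + a)) D)
      ≡⟨ accepts-U prev k h a (replicate (suc (h + a)) D) ⟩
    accepts i j prev′ (suc k) (h + a) (replicate (suc (h + a)) D)
      ≡⟨ cong₂ _∧_ (lukFrom-finalDescent (h + a)) (cong₂ (statsAre i j) (upSum-lastUp y) (upSum-lastUp dval)) ⟩
    statsAre i j (upSum y prev + h) (upSum dval prev + lastDval prev) ∎
    where
    up = info (U a) k h (lastDval prev) nothing
    prev′ = prev ++ [ up ]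
    upSum-lastUp : ∀ f → upSum f (process prev′ (suc k) (h + a) (replicate (suc (h + a)) D)) ≡ upSum f prev + f up
    upSum-lastUp f = trans (cong (λ L → sum (map f L)) (upSteps-finalDescent (h + a) prev′ (suc k) (h + a)))
                           (upSum-∷ʳ-up f prev a k h (lastDval prev))

-- Changing the degree of the last up-step

module _ (i j : ℕ) where

  -- Only the final step may go down from height 0.
  shuffleCount-descentFromZero : ∀ prev k u us n → shuffleCount (λ w → accepts i j prev k 0 (D ∷ w)) (u ∷ us) n ≡ 0
  shuffleCount-descentFromZero prev k u us n = shuffleCount-∷-none u us n (λ _ _ → refl)

  lastDegree-irrelevant : ∀ K h prev k a b →
    shuffleCount (accepts i j prev k h) (map U (K ++ [ a ])) (suc (h + sum (K ++ [ a ])))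
    ≡ shuffleCount (accepts i j prev k h) (map U (K ++ [ b ])) (suc (h + sum (K ++ [ b ])))
  firstDown-lastDegree-irrelevant : ∀ K h prev k a b →
    shuffleCount (λ w → accepts i j prev k h (D ∷ w)) (map U (K ++ [ a ])) (h + sum (K ++ [ a ]))
    ≡ shuffleCount (λ w → accepts i j prev k h (D ∷ w)) (map U (K ++ [ b ])) (h + sum (K ++ [ b ]))

  lastDegree-irrelevant [] h prev k a b =
    cong₂ _+_ (cong indicator (trans (lastUp a) (sym (lastUp b)))) (firstDown-lastDegree-irrelevant [] h prev k a b)
    where
    lastUp : ∀ a → accepts i j prev k h (U a ∷ replicate (suc (h + (a + 0))) D)
                   ≡ statsAre i j (upSum y prev + h) (upSum dval prev + lastDval prev)
    lastUp a = accepts-lastUp i j prev k h a _ (cong (h +_) (+-identityʳ a))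
  lastDegree-irrelevant (k′ ∷ K) h prev k a b =
    cong₂ _+_ (trans (firstUp a) (trans (lastDegree-irrelevant K (h + k′) prev′ (suc k) a b) (sym (firstUp b))))
              (firstDown-lastDegree-irrelevant (k′ ∷ K) h prev k a b)
    where
    prev′ = prev ++ [ info (U k′) k h (lastDval prev) nothing ]
    firstUp : ∀ a →
      shuffleCount (λ w → accepts i j prev k h (U k′ ∷ w)) (map U (K ++ [ a ])) (suc (h + (k′ + sum (K ++ [ a ]))))
      ≡ shuffleCount (accepts i j prev′ (suc k) (h + k′)) (map U (K ++ [ a ])) (suc (h + k′ + sum (K ++ [ a ])))
    firstUp a = trans (shuffleCount-cong (map U (K ++ [ a ])) _ (accepts-U i j prev k h k′))
                      (cong (λ n → shuffleCount (accepts i j prev′ (suc k) (h + k′)) (map U (K ++ [ a ])) (suc n))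
                            (sym (+-assoc h k′ _)))

  firstDown-lastDegree-irrelevant []       zero prev k a b =
    trans (shuffleCount-descentFromZero prev k (U a) [] (a + 0)) (sym (shuffleCount-descentFromZero prev k (U b) [] (b + 0)))
  firstDown-lastDegree-irrelevant (k′ ∷ K) zero prev k a b =
    trans (shuffleCount-descentFromZero prev k (U k′) (map U (K ++ [ a ])) (k′ + sum (K ++ [ a ])))
          (sym (shuffleCount-descentFromZero prev k (U k′) (map U (K ++ [ b ])) (k′ + sum (K ++ [ b ]))))
  firstDown-lastDegree-irrelevant K (suc h) prev k a b =
    trans (shuffleCount-cong (map U (K ++ [ a ])) _ (accepts-D i j prev k h))
          (trans (lastDegree-irrelevant K h prev′ (suc k) a b)
                 (sym (shuffleCount-cong (map U (K ++ [ b ])) _ (accepts-D i j prev k h))))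
    where prev′ = prev ++ [ downInfo prev k (suc h) ]

Ctilde-lastDegree-irrelevant : ∀ K a b i j → Ctilde (K ++ [ a ]) i j ≡ Ctilde (K ++ [ b ]) i j
Ctilde-lastDegree-irrelevant K a b i j = begin
  Ctilde (K ++ [ a ]) i j                                                       ≡⟨ Ctilde≡shuffleCount (K ++ [ a ]) i j ⟩
  shuffleCount (accepts i j [] 0 0) (map U (K ++ [ a ])) (suc (sum (K ++ [ a ]))) ≡⟨ lastDegree-irrelevant i j K 0 [] 0 a b ⟩
  shuffleCount (accepts i j [] 0 0) (map U (K ++ [ b ])) (suc (sum (K ++ [ b ]))) ≡⟨ Ctilde≡shuffleCount (K ++ [ b ]) i j ⟨
  Ctilde (K ++ [ b ]) i j                                                       ∎

-- Paths with profile (k₁, k₂, 0)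

≤ᵇ-false : ∀ {m n} → n < m → (m ≤ᵇ n) ≡ false
≤ᵇ-false {m} {n} n<m with m ≤ᵇ n in eq
... | false = refl
... | true  = contradiction (≤ᵇ⇒≤ m n (subst T (sym eq) tt)) (<⇒≱ n<m)

covers-up : ∀ ℓ a k h d → 0 < a → h ≤ ℓ → ℓ < h + a → covers ℓ (info (U a) k h d nothing) ≡ true
covers-up ℓ a k h d 0<a h≤ℓ ℓ<h+a
  rewrite Equivalence.to T-≡ (<⇒<ᵇ 0<a) | Equivalence.to T-≡ (≤⇒≤ᵇ h≤ℓ) | Equivalence.to T-≡ (<⇒<ᵇ ℓ<h+a) = refl

covers-below : ∀ ℓ a k h d → ℓ < h → covers ℓ (info (U a) k h d nothing) ≡ false
covers-below ℓ a k h d ℓ<h rewrite ≤ᵇ-false ℓ<h = ∧-zeroʳ (0 <ᵇ a)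

threeUpPath : ℕ → ℕ → ℕ → ℕ → ℕ → List Step
threeUpPath k₁ k₂ r s t = U k₁ ∷ replicate r D ++ U k₂ ∷ replicate s D ++ U 0 ∷ replicate t D

firstUp : ℕ → Info
firstUp k₁ = info (U k₁) 0 0 0 nothing

secondUp : ℕ → ℕ → ℕ → Info
secondUp k₁ k₂ r = info (U k₂) (suc r) (k₁ ∸ r) r nothing

infosAfterFirstRun : ℕ → ℕ → List Info
infosAfterFirstRun k₁ r = firstUp k₁ ∷ matchedDowns (firstUp k₁) 0 1 k₁ r

infosAfterSecondRun : ℕ → ℕ → ℕ → ℕ → List Info
infosAfterSecondRun k₁ k₂ r s =
  (infosAfterFirstRun k₁ r ++ [ secondUp k₁ k₂ r ]) ++ matchedDowns (secondUp k₁ k₂ r) 0 (suc (suc r)) (k₁ ∸ r + k₂) s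

lastDval-infosAfterFirstRun : ∀ k₁ r → lastDval (infosAfterFirstRun k₁ r) ≡ r
lastDval-infosAfterFirstRun k₁ zero    = refl
lastDval-infosAfterFirstRun k₁ (suc r) = lastDval-matchedDowns [ firstUp k₁ ] (firstUp k₁) 0 1 k₁ r

lastDval-infosAfterSecondRun : ∀ k₁ k₂ r s → lastDval (infosAfterSecondRun k₁ k₂ r s) ≡ r + s
lastDval-infosAfterSecondRun k₁ k₂ r zero =
  trans (cong lastDval (++-identityʳ (infosAfterFirstRun k₁ r ++ [ secondUp k₁ k₂ r ])))
        (trans (lastDval-∷ʳ (infosAfterFirstRun k₁ r) (secondUp k₁ k₂ r)) (sym (+-identityʳ r)))
lastDval-infosAfterSecondRun k₁ k₂ r (suc s) =
  lastDval-matchedDowns (infosAfterFirstRun k₁ r ++ [ secondUp k₁ k₂ r ]) (secondUp k₁ k₂ r) 0 (suc (suc r)) (k₁ ∸ r + k₂) s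

upSteps-infosAfterSecondRun : ∀ k₁ k₂ r s → upSteps (infosAfterSecondRun k₁ k₂ r s) ≡ firstUp k₁ ∷ secondUp k₁ k₂ r ∷ []
upSteps-infosAfterSecondRun k₁ k₂ r s = begin
  upSteps ((L ++ [ secondUp k₁ k₂ r ]) ++ ds₂)                 ≡⟨ filter-++ isUp? (L ++ [ secondUp k₁ k₂ r ]) ds₂ ⟩
  upSteps (L ++ [ secondUp k₁ k₂ r ]) ++ upSteps ds₂
    ≡⟨ cong₂ _++_ (filter-++ isUp? L _) (upSteps-matchedDowns (secondUp k₁ k₂ r) 0 _ _ s) ⟩
  (firstUp k₁ ∷ upSteps ds₁ ++ [ secondUp k₁ k₂ r ]) ++ []     ≡⟨ ++-identityʳ _ ⟩
  firstUp k₁ ∷ upSteps ds₁ ++ [ secondUp k₁ k₂ r ]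
    ≡⟨ cong (λ M → firstUp k₁ ∷ M ++ [ secondUp k₁ k₂ r ]) (upSteps-matchedDowns (firstUp k₁) 0 1 k₁ r) ⟩
  firstUp k₁ ∷ secondUp k₁ k₂ r ∷ []                           ∎
  where
  L   = infosAfterFirstRun k₁ r
  ds₁ = matchedDowns (firstUp k₁) 0 1 k₁ r
  ds₂ = matchedDowns (secondUp k₁ k₂ r) 0 (suc (suc r)) (k₁ ∸ r + k₂) s

upSum-infosAfterSecondRun : ∀ f k₁ k₂ r s →
  upSum f (infosAfterSecondRun k₁ k₂ r s) ≡ f (firstUp k₁) + f (secondUp k₁ k₂ r)
upSum-infosAfterSecondRun f k₁ k₂ r s =
  trans (cong (λ L → sum (map f L)) (upSteps-infosAfterSecondRun k₁ k₂ r s)) (cong (f (firstUp k₁) +_) (+-identityʳ _))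

m∸[1+n]<m : ∀ {h l} → suc l ≤ h → h ∸ suc l < h
m∸[1+n]<m l<h = ∸-monoʳ-< z<s l<h

replicate-+-++ : ∀ m n (w : List Step) → replicate (m + n) D ++ w ≡ replicate m D ++ replicate n D ++ w
replicate-+-++ zero    n w = refl
replicate-+-++ (suc m) n w = cong (D ∷_) (replicate-+-++ m n w)

lowRow : ℕ → ℕ → ℕ → ℕ → ℕ → ℕ
lowRow i j k₁ k₂ r = ∑[ s < suc k₂ ] indicator (statsAre i j (k₁ ∸ r + (k₁ ∸ r + (k₂ ∸ s))) (r + (r + s)))

highRow : ℕ → ℕ → ℕ → ℕ → ℕ
highRow i j k₁ r = ∑[ c < k₁ ∸ r ] indicator (statsAre i j (k₁ ∸ r + c) (k₁ ∸ c + r))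

lowPathCount : ℕ → ℕ → ℕ → ℕ → ℕ
lowPathCount i j k₁ k₂ = ∑[ r < suc k₁ ] lowRow i j k₁ k₂ r

highPathCount : ℕ → ℕ → ℕ → ℕ
highPathCount i j k₁ = ∑[ r < suc k₁ ] highRow i j k₁ r

lowPathCount-swap : ∀ i j k₁ k₂ → lowPathCount i j k₁ k₂ ≡ lowPathCount j i k₁ k₂
lowPathCount-swap i j k₁ k₂ = begin
  lowPathCount i j k₁ k₂
    ≡⟨ ∑-reverse (suc k₁) (λ r → ∑[ s < suc k₂ ] term r s) ⟩
  ∑[ r < suc k₁ ] ∑[ s < suc k₂ ] term (k₁ ∸ r) s
    ≡⟨ ∑-cong (suc k₁) (λ r _ → ∑-reverse (suc k₂) (term (k₁ ∸ r))) ⟩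
  ∑[ r < suc k₁ ] ∑[ s < suc k₂ ] term (k₁ ∸ r) (k₂ ∸ s)
    ≡⟨ ∑-cong (suc k₁) (λ r r<1+k₁ → ∑-cong (suc k₂) (λ s s<1+k₂ → reflect (s≤s⁻¹ r<1+k₁) (s≤s⁻¹ s<1+k₂))) ⟩
  lowPathCount j i k₁ k₂ ∎
  where
  term : ℕ → ℕ → ℕ
  term r s = indicator (statsAre i j (k₁ ∸ r + (k₁ ∸ r + (k₂ ∸ s))) (r + (r + s)))
  reflect : ∀ {r s} → r ≤ k₁ → s ≤ k₂ →
    term (k₁ ∸ r) (k₂ ∸ s) ≡ indicator (statsAre j i (k₁ ∸ r + (k₁ ∸ r + (k₂ ∸ s))) (r + (r + s)))
  reflect {r} {s} r≤k₁ s≤k₂ rewrite m∸[m∸n]≡n r≤k₁ | m∸[m∸n]≡n s≤k₂ =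
    cong indicator (statsAre-swap i j (r + (r + s)) (k₁ ∸ r + (k₁ ∸ r + (k₂ ∸ s))))

highPathCount-swap : ∀ i j k₁ → highPathCount i j k₁ ≡ highPathCount j i k₁
highPathCount-swap i j k₁ =
  trans (∑-triangle-transpose k₁ (λ r c → indicator (statsAre i j (k₁ ∸ r + c) (k₁ ∸ c + r))))
        (∑-cong (suc k₁) λ r _ → ∑-cong (k₁ ∸ r) λ c _ → cong indicator (statsAre-swap i j (k₁ ∸ c + r) (k₁ ∸ r + c)))

module _ (i j k₁ k₂ : ℕ) where

  accepts-threeUp-prefix : ∀ r w → r ≤ k₁ →
    accepts i j [] 0 0 (U k₁ ∷ replicate r D ++ U k₂ ∷ w)
    ≡ accepts i j (infosAfterFirstRun k₁ r ++ [ secondUp k₁ k₂ r ]) (suc (suc r)) (k₁ ∸ r + k₂) w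
  accepts-threeUp-prefix r w r≤k₁ = begin
    accepts i j [ firstUp k₁ ] 1 k₁ (replicate r D ++ U k₂ ∷ w)
      ≡⟨ accepts-matchedRun i j r [ firstUp k₁ ] 1 k₁ (firstUp k₁) 0 (U k₂ ∷ w) r≤k₁ coveredByFirst refl ⟩
    accepts i j (infosAfterFirstRun k₁ r) (suc r) (k₁ ∸ r) (U k₂ ∷ w)
      ≡⟨ accepts-U i j (infosAfterFirstRun k₁ r) (suc r) (k₁ ∸ r) k₂ w ⟩
    accepts i j (infosAfterFirstRun k₁ r ++ [ info (U k₂) (suc r) (k₁ ∸ r) (lastDval (infosAfterFirstRun k₁ r)) nothing ])
                (suc (suc r)) (k₁ ∸ r + k₂) w
      ≡⟨ cong (λ d → accepts i j (infosAfterFirstRun k₁ r ++ [ info (U k₂) (suc r) (k₁ ∸ r) d nothing ])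
                            (suc (suc r)) (k₁ ∸ r + k₂) w)
              (lastDval-infosAfterFirstRun k₁ r) ⟩
    accepts i j (infosAfterFirstRun k₁ r ++ [ secondUp k₁ k₂ r ]) (suc (suc r)) (k₁ ∸ r + k₂) w ∎
    where
    coveredByFirst : ∀ l → l < r → firstWhere (covers (k₁ ∸ suc l)) [ firstUp k₁ ] ≡ just (firstUp k₁)
    coveredByFirst l l<r = cong (λ b → if b then just (firstUp k₁) else nothing)
                                (covers-up (k₁ ∸ suc l) k₁ 0 0 0 (<-≤-trans z<s l<k₁) z≤n (m∸[1+n]<m l<k₁))
      where l<k₁ = <-≤-trans l<r r≤k₁

  accepts-threeUp-firstRunTooLong : ∀ r s t → k₁ < r → accepts i j [] 0 0 (threeUpPath k₁ k₂ r s t) ≡ false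
  accepts-threeUp-firstRunTooLong r s t k₁<r = accepts-overDescent i j r [ firstUp k₁ ] 1 k₁ (U k₂) _ k₁<r

  secondRun-matched : ∀ r l → l < k₂ →
    firstWhere (covers (k₁ ∸ r + k₂ ∸ suc l)) (reverse (infosAfterFirstRun k₁ r ++ [ secondUp k₁ k₂ r ]))
    ≡ just (secondUp k₁ k₂ r)
  secondRun-matched r l l<k₂ = trans (firstWhere-∷ʳ (covers ℓ) (infosAfterFirstRun k₁ r) (secondUp k₁ k₂ r))
    (cong (λ b → if b then just (secondUp k₁ k₂ r) else firstWhere (covers ℓ) (reverse (infosAfterFirstRun k₁ r)))
          (covers-up ℓ k₂ (suc r) a r (<-≤-trans z<s l<k₂) a≤ℓ (m∸[1+n]<m (≤-trans l<k₂ (m≤n+m k₂ a)))))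
    where
    a = k₁ ∸ r
    ℓ = a + k₂ ∸ suc l
    a≤ℓ : a ≤ ℓ
    a≤ℓ = subst (a ≤_) (sym (+-∸-assoc a l<k₂)) (m≤m+n a (k₂ ∸ suc l))

  thirdRun-matched : ∀ r l → l < k₁ ∸ r →
    firstWhere (covers (k₁ ∸ r ∸ suc l)) (reverse (infosAfterSecondRun k₁ k₂ r k₂)) ≡ just (firstUp k₁)
  thirdRun-matched r l l<a = begin
    firstWhere (covers ℓ) (reverse (infosAfterSecondRun k₁ k₂ r k₂))
      ≡⟨ firstWhere-covers-matchedDowns ℓ (infosAfterFirstRun k₁ r ++ [ secondUp k₁ k₂ r ]) (secondUp k₁ k₂ r) 0 _ _ k₂ ⟩
    firstWhere (covers ℓ) (reverse (infosAfterFirstRun k₁ r ++ [ secondUp k₁ k₂ r ]))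
      ≡⟨ firstWhere-∷ʳ (covers ℓ) (infosAfterFirstRun k₁ r) (secondUp k₁ k₂ r) ⟩
    (if covers ℓ (secondUp k₁ k₂ r) then just (secondUp k₁ k₂ r) else firstWhere (covers ℓ) (reverse (infosAfterFirstRun k₁ r)))
      ≡⟨ cong (λ b → if b then just (secondUp k₁ k₂ r) else firstWhere (covers ℓ) (reverse (infosAfterFirstRun k₁ r)))
              (covers-below ℓ k₂ (suc r) a r ℓ<a) ⟩
    firstWhere (covers ℓ) (reverse ([ firstUp k₁ ] ++ matchedDowns (firstUp k₁) 0 1 k₁ r))
      ≡⟨ firstWhere-covers-matchedDowns ℓ [ firstUp k₁ ] (firstUp k₁) 0 1 k₁ r ⟩
    (if covers ℓ (firstUp k₁) then just (firstUp k₁) else nothing)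
      ≡⟨ cong (λ b → if b then just (firstUp k₁) else nothing)
              (covers-up ℓ k₁ 0 0 0 (<-≤-trans z<s (≤-trans l<a (m∸n≤m k₁ r))) z≤n (<-≤-trans ℓ<a (m∸n≤m k₁ r))) ⟩
    just (firstUp k₁) ∎
    where
    a = k₁ ∸ r
    ℓ = a ∸ suc l
    ℓ<a : ℓ < a
    ℓ<a = m∸[1+n]<m l<a

  countMatched-secondUp : ∀ r → countMatched (suc r) (infosAfterFirstRun k₁ r ++ [ secondUp k₁ k₂ r ]) ≡ 0
  countMatched-secondUp r =
    trans (countMatched-++ (suc r) (matchedDowns (firstUp k₁) 0 1 k₁ r) [ secondUp k₁ k₂ r ])
          (cong (_+ 0) (countMatched-matchedDowns-other (suc r) (firstUp k₁) 0 1 k₁ r refl))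

  countMatched-firstUp : ∀ r → countMatched 0 (infosAfterSecondRun k₁ k₂ r k₂) ≡ r
  countMatched-firstUp r = begin
    countMatched 0 ((infosAfterFirstRun k₁ r ++ [ secondUp k₁ k₂ r ]) ++ ds₂)
      ≡⟨ countMatched-++ 0 (infosAfterFirstRun k₁ r ++ [ secondUp k₁ k₂ r ]) ds₂ ⟩
    countMatched 0 (ds₁ ++ [ secondUp k₁ k₂ r ]) + countMatched 0 ds₂
      ≡⟨ cong₂ _+_ (countMatched-++ 0 ds₁ [ secondUp k₁ k₂ r ])
                   (countMatched-matchedDowns-other 0 (secondUp k₁ k₂ r) 0 _ _ k₂ refl) ⟩
    countMatched 0 ds₁ + 0 + 0
      ≡⟨ cong (λ n → n + 0 + 0) (countMatched-matchedDowns (firstUp k₁) 0 1 k₁ r) ⟩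
    r + 0 + 0
      ≡⟨ trans (+-identityʳ _) (+-identityʳ r) ⟩
    r ∎
    where
    ds₁ = matchedDowns (firstUp k₁) 0 1 k₁ r
    ds₂ = matchedDowns (secondUp k₁ k₂ r) 0 (suc (suc r)) (k₁ ∸ r + k₂) k₂

  accepts-threeUp-secondRunTooLong : ∀ r t → r ≤ k₁ → accepts i j [] 0 0 (threeUpPath k₁ k₂ r (suc (k₁ ∸ r + k₂)) t) ≡ false
  accepts-threeUp-secondRunTooLong r t r≤k₁ =
    trans (accepts-threeUp-prefix r _ r≤k₁)
          (accepts-overDescent i j (suc (k₁ ∸ r + k₂)) (infosAfterFirstRun k₁ r ++ [ secondUp k₁ k₂ r ]) _ _ (U 0) _ ≤-refl)

  accepts-threeUp-low : ∀ r s → r ≤ k₁ → s ≤ k₂ →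
    accepts i j [] 0 0 (threeUpPath k₁ k₂ r s (suc (k₁ ∸ r + (k₂ ∸ s))))
    ≡ statsAre i j (k₁ ∸ r + (k₁ ∸ r + (k₂ ∸ s))) (r + (r + s))
  accepts-threeUp-low r s r≤k₁ s≤k₂ = begin
    accepts i j [] 0 0 (threeUpPath k₁ k₂ r s (suc t))
      ≡⟨ accepts-threeUp-prefix r _ r≤k₁ ⟩
    accepts i j L (suc (suc r)) (a + k₂) (replicate s D ++ U 0 ∷ replicate (suc t) D)
      ≡⟨ accepts-matchedRun i j s L _ _ (secondUp k₁ k₂ r) 0 _ (≤-trans s≤k₂ (m≤n+m k₂ a))
                            (λ l l<s → secondRun-matched r l (<-≤-trans l<s s≤k₂)) (countMatched-secondUp r) ⟩
    accepts i j L₂ (suc (suc r) + s) (a + k₂ ∸ s) (U 0 ∷ replicate (suc t) D)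
      ≡⟨ accepts-lastUp i j L₂ _ (a + k₂ ∸ s) 0 t (trans (sym (+-∸-assoc a s≤k₂)) (sym (+-identityʳ _))) ⟩
    statsAre i j (upSum y L₂ + (a + k₂ ∸ s)) (upSum dval L₂ + lastDval L₂)
      ≡⟨ cong₂ (statsAre i j) (cong₂ _+_ (upSum-infosAfterSecondRun y k₁ k₂ r s) (+-∸-assoc a s≤k₂))
                              (cong₂ _+_ (upSum-infosAfterSecondRun dval k₁ k₂ r s) (lastDval-infosAfterSecondRun k₁ k₂ r s)) ⟩
    statsAre i j (a + (a + (k₂ ∸ s))) (r + (r + s)) ∎
    where
    a  = k₁ ∸ r
    t  = a + (k₂ ∸ s)
    L  = infosAfterFirstRun k₁ r ++ [ secondUp k₁ k₂ r ]
    L₂ = infosAfterSecondRun k₁ k₂ r s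

  accepts-threeUp-high : ∀ r c → r ≤ k₁ → c < k₁ ∸ r →
    accepts i j [] 0 0 (threeUpPath k₁ k₂ r (k₂ + (k₁ ∸ r ∸ c)) (suc c)) ≡ statsAre i j (k₁ ∸ r + c) (k₁ ∸ c + r)
  accepts-threeUp-high r c r≤k₁ c<a = begin
    accepts i j [] 0 0 (U k₁ ∷ replicate r D ++ U k₂ ∷ replicate (k₂ + e) D ++ rest)
      ≡⟨ cong (λ v → accepts i j [] 0 0 (U k₁ ∷ replicate r D ++ U k₂ ∷ v)) (replicate-+-++ k₂ e rest) ⟩
    accepts i j [] 0 0 (U k₁ ∷ replicate r D ++ U k₂ ∷ replicate k₂ D ++ replicate e D ++ rest)
      ≡⟨ accepts-threeUp-prefix r _ r≤k₁ ⟩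
    accepts i j L (suc (suc r)) (a + k₂) (replicate k₂ D ++ replicate e D ++ rest)
      ≡⟨ accepts-matchedRun i j k₂ L _ _ (secondUp k₁ k₂ r) 0 _ (m≤n+m k₂ a)
                            (secondRun-matched r) (countMatched-secondUp r) ⟩
    accepts i j L₂ (suc (suc r) + k₂) (a + k₂ ∸ k₂) (replicate e D ++ rest)
      ≡⟨ cong (λ h → accepts i j L₂ (suc (suc r) + k₂) h (replicate e D ++ rest)) (m+n∸n≡m a k₂) ⟩
    accepts i j L₂ (suc (suc r) + k₂) a (replicate e D ++ rest)
      ≡⟨ accepts-matchedRun i j e L₂ _ a (firstUp k₁) r rest (m∸n≤m a c)
                            (λ l l<e → thirdRun-matched r l (<-≤-trans l<e (m∸n≤m a c))) (countMatched-firstUp r) ⟩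
    accepts i j L₃ (suc (suc r) + k₂ + e) (a ∸ e) rest
      ≡⟨ accepts-lastUp i j L₃ _ (a ∸ e) 0 c (trans (sym (m∸[m∸n]≡n c≤a)) (sym (+-identityʳ _))) ⟩
    statsAre i j (upSum y L₃ + (a ∸ e)) (upSum dval L₃ + lastDval L₃)
      ≡⟨ cong₂ (statsAre i j) (cong₂ _+_ (upSum-L₃ y) (m∸[m∸n]≡n c≤a)) (cong₂ _+_ (upSum-L₃ dval) lastDval-L₃) ⟩
    statsAre i j (a + c) (r + (k₁ ∸ c))
      ≡⟨ cong (statsAre i j (a + c)) (+-comm r (k₁ ∸ c)) ⟩
    statsAre i j (a + c) (k₁ ∸ c + r) ∎
    where
    a    = k₁ ∸ r
    e    = a ∸ c
    c≤a  = <⇒≤ c<a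
    rest = U 0 ∷ replicate (suc c) D
    L    = infosAfterFirstRun k₁ r ++ [ secondUp k₁ k₂ r ]
    L₂   = infosAfterSecondRun k₁ k₂ r k₂
    L₃   = L₂ ++ matchedDowns (firstUp k₁) r (suc (suc r) + k₂) a e
    upSum-L₃ : ∀ f → upSum f L₃ ≡ f (firstUp k₁) + f (secondUp k₁ k₂ r)
    upSum-L₃ f = trans (upSum-++-matchedDowns f L₂ (firstUp k₁) r _ a e) (upSum-infosAfterSecondRun f k₁ k₂ r k₂)
    lastDval-L₃ : lastDval L₃ ≡ k₁ ∸ c
    lastDval-L₃ = begin
      lastDval (L₂ ++ matchedDowns (firstUp k₁) r (suc (suc r) + k₂) a e)
        ≡⟨ cong (λ n → lastDval (L₂ ++ matchedDowns (firstUp k₁) r (suc (suc r) + k₂) a n)) (+-∸-assoc 1 c<a) ⟩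
      lastDval (L₂ ++ matchedDowns (firstUp k₁) r (suc (suc r) + k₂) a (suc (a ∸ suc c)))
        ≡⟨ lastDval-matchedDowns L₂ (firstUp k₁) r _ a (a ∸ suc c) ⟩
      suc (r + (a ∸ suc c))          ≡⟨ +-suc r (a ∸ suc c) ⟨
      r + suc (a ∸ suc c)            ≡⟨ cong (r +_) (+-∸-assoc 1 c<a) ⟨
      r + (a ∸ c)                    ≡⟨ +-∸-assoc r c≤a ⟨
      r + a ∸ c                      ≡⟨ cong (_∸ c) (m+[n∸m]≡n r≤k₁) ⟩
      k₁ ∸ c                         ∎

  Ctilde-threeUp-enumerate :
    Ctilde (k₁ ∷ k₂ ∷ 0 ∷ []) i j
    ≡ ∑[ r < suc (suc (k₁ + k₂)) ] ∑[ s < suc (suc (k₁ + k₂) ∸ r) ]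
        indicator (accepts i j [] 0 0 (threeUpPath k₁ k₂ r s (suc (k₁ + k₂) ∸ r ∸ s)))
  Ctilde-threeUp-enumerate = begin
    Ctilde (k₁ ∷ k₂ ∷ 0 ∷ []) i j
      ≡⟨ Ctilde≡shuffleCount (k₁ ∷ k₂ ∷ 0 ∷ []) i j ⟩
    shuffleCount P ups (suc (k₁ + (k₂ + 0)))
      ≡⟨ cong (λ n → shuffleCount P ups (suc (k₁ + n))) (+-identityʳ k₂) ⟩
    shuffleCount (λ w → P (U k₁ ∷ w)) (U k₂ ∷ U 0 ∷ []) N + shuffleCount (λ w → P (D ∷ w)) ups (k₁ + k₂)
      ≡⟨ cong (shuffleCount (λ w → P (U k₁ ∷ w)) (U k₂ ∷ U 0 ∷ []) N +_)
              (shuffleCount-descentFromZero i j [] 0 (U k₁) (U k₂ ∷ U 0 ∷ []) (k₁ + k₂)) ⟩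
    shuffleCount (λ w → P (U k₁ ∷ w)) (U k₂ ∷ U 0 ∷ []) N + 0
      ≡⟨ +-identityʳ _ ⟩
    shuffleCount (λ w → P (U k₁ ∷ w)) (U k₂ ∷ U 0 ∷ []) N
      ≡⟨ shuffleCount-∷ (λ w → P (U k₁ ∷ w)) (U k₂) [ U 0 ] N ⟩
    ∑[ r < suc N ] shuffleCount (λ w → P (U k₁ ∷ replicate r D ++ U k₂ ∷ w)) [ U 0 ] (N ∸ r)
      ≡⟨ ∑-cong (suc N) (λ r _ → shuffleCount-∷ (λ w → P (U k₁ ∷ replicate r D ++ U k₂ ∷ w)) (U 0) [] (N ∸ r)) ⟩
    ∑[ r < suc N ] ∑[ s < suc (N ∸ r) ] indicator (P (threeUpPath k₁ k₂ r s (N ∸ r ∸ s))) ∎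
    where
    P   = accepts i j [] 0 0
    ups = U k₁ ∷ U k₂ ∷ U 0 ∷ []
    N   = suc (k₁ + k₂)

  threeUpRow-firstRunTooLong : ∀ r → k₁ < r → ∀ n (t : ℕ → ℕ) →
    ∑[ s < n ] indicator (accepts i j [] 0 0 (threeUpPath k₁ k₂ r s (t s))) ≡ 0
  threeUpRow-firstRunTooLong r k₁<r n t = ∑-zero n (λ s _ → cong indicator (accepts-threeUp-firstRunTooLong r s (t s) k₁<r))

  threeUpRow : ∀ r → r ≤ k₁ →
    ∑[ s < suc (suc (k₁ + k₂) ∸ r) ] indicator (accepts i j [] 0 0 (threeUpPath k₁ k₂ r s (suc (k₁ + k₂) ∸ r ∸ s)))
    ≡ lowRow i j k₁ k₂ r + highRow i j k₁ r
  threeUpRow r r≤k₁ = begin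
    ∑[ s < suc (suc (k₁ + k₂) ∸ r) ] indicator (accepts i j [] 0 0 (threeUpPath k₁ k₂ r s (suc (k₁ + k₂) ∸ r ∸ s)))
      ≡⟨ cong (λ n → ∑[ s < suc n ] H n s) remaining ⟩
    ∑[ s < suc m ] H m s
      ≡⟨ ∑-last m (H m) ⟩
    ∑[ s < m ] H m s + H m m
      ≡⟨ cong₂ _+_ (cong (λ n → ∑< n (H m)) (cong suc (+-comm a k₂)))
                   (cong indicator (accepts-threeUp-secondRunTooLong r (m ∸ m) r≤k₁)) ⟩
    ∑[ s < suc k₂ + a ] H m s + 0
      ≡⟨ +-identityʳ _ ⟩
    ∑[ s < suc k₂ + a ] H m s
      ≡⟨ ∑-+ (suc k₂) a (H m) ⟩
    ∑[ s < suc k₂ ] H m s + ∑[ x < a ] H m (suc k₂ + x)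
      ≡⟨ cong₂ _+_ (∑-cong (suc k₂) λ s s<1+k₂ → low (s≤s⁻¹ s<1+k₂)) (∑-reverse a (λ x → H m (suc k₂ + x))) ⟩
    ∑[ s < suc k₂ ] indicator (statsAre i j (a + (a + (k₂ ∸ s))) (r + (r + s))) + ∑[ c < a ] H m (suc k₂ + (a ∸ suc c))
      ≡⟨ cong (lowRow i j k₁ k₂ r +_) (∑-cong a λ c c<a → high c<a) ⟩
    lowRow i j k₁ k₂ r + highRow i j k₁ r ∎
    where
    a = k₁ ∸ r
    m = suc (a + k₂)
    H : ℕ → ℕ → ℕ
    H n s = indicator (accepts i j [] 0 0 (threeUpPath k₁ k₂ r s (n ∸ s)))
    remaining : suc (k₁ + k₂) ∸ r ≡ m
    remaining = trans (+-∸-comm k₂ (m≤n⇒m≤1+n r≤k₁)) (cong (_+ k₂) (+-∸-assoc 1 r≤k₁))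
    low : ∀ {s} → s ≤ k₂ → H m s ≡ indicator (statsAre i j (a + (a + (k₂ ∸ s))) (r + (r + s)))
    low {s} s≤k₂ = trans (cong (λ t → indicator (accepts i j [] 0 0 (threeUpPath k₁ k₂ r s t))) (+-∸-assoc (suc a) s≤k₂))
                         (cong indicator (accepts-threeUp-low r s r≤k₁ s≤k₂))
    high : ∀ {c} → c < a → H m (suc k₂ + (a ∸ suc c)) ≡ indicator (statsAre i j (a + c) (k₁ ∸ c + r))
    high {c} c<a = begin
      H m (suc k₂ + (a ∸ suc c))
        ≡⟨ cong (H m) (trans (sym (+-suc k₂ (a ∸ suc c))) (cong (k₂ +_) (sym (+-∸-assoc 1 c<a)))) ⟩
      H m (k₂ + (a ∸ c))
        ≡⟨ cong (λ t → indicator (accepts i j [] 0 0 (threeUpPath k₁ k₂ r (k₂ + (a ∸ c)) t))) finalRun ⟩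
      indicator (accepts i j [] 0 0 (threeUpPath k₁ k₂ r (k₂ + (a ∸ c)) (suc c)))
                                      ≡⟨ cong indicator (accepts-threeUp-high r c r≤k₁ c<a) ⟩
      indicator (statsAre i j (a + c) (k₁ ∸ c + r)) ∎
      where
      finalRun : m ∸ (k₂ + (a ∸ c)) ≡ suc c
      finalRun = begin
        suc (a + k₂) ∸ (k₂ + (a ∸ c))    ≡⟨ cong (_∸ (k₂ + (a ∸ c))) (trans (cong suc (+-comm a k₂)) (sym (+-suc k₂ a))) ⟩
        k₂ + suc a ∸ (k₂ + (a ∸ c))      ≡⟨ [m+n]∸[m+o]≡n∸o k₂ (suc a) (a ∸ c) ⟩
        suc a ∸ (a ∸ c)                  ≡⟨ +-∸-assoc 1 (m∸n≤m a c) ⟩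
        suc (a ∸ (a ∸ c))                ≡⟨ cong suc (m∸[m∸n]≡n (<⇒≤ c<a)) ⟩
        suc c                            ∎

  Ctilde-threeUp : Ctilde (k₁ ∷ k₂ ∷ 0 ∷ []) i j ≡ lowPathCount i j k₁ k₂ + highPathCount i j k₁
  Ctilde-threeUp = begin
    Ctilde (k₁ ∷ k₂ ∷ 0 ∷ []) i j
      ≡⟨ Ctilde-threeUp-enumerate ⟩
    ∑[ r < suc N ] Row r
      ≡⟨ cong (λ n → ∑< n Row) (cong suc (sym (+-suc k₁ k₂))) ⟩
    ∑[ r < suc k₁ + suc k₂ ] Row r
      ≡⟨ ∑-+ (suc k₁) (suc k₂) Row ⟩
    ∑[ r < suc k₁ ] Row r + ∑[ x < suc k₂ ] Row (suc k₁ + x)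
      ≡⟨ cong₂ _+_ (∑-cong (suc k₁) λ r r<1+k₁ → threeUpRow r (s≤s⁻¹ r<1+k₁))
                   (∑-zero (suc k₂) λ x _ → threeUpRow-firstRunTooLong (suc k₁ + x) (s≤s (m≤m+n k₁ x))
                                                                (suc (N ∸ (suc k₁ + x))) (λ s → N ∸ (suc k₁ + x) ∸ s)) ⟩
    ∑[ r < suc k₁ ] (lowRow i j k₁ k₂ r + highRow i j k₁ r) + 0
      ≡⟨ +-identityʳ _ ⟩
    ∑[ r < suc k₁ ] (lowRow i j k₁ k₂ r + highRow i j k₁ r)
      ≡⟨ ∑-distrib (suc k₁) (lowRow i j k₁ k₂) (highRow i j k₁) ⟩
    lowPathCount i j k₁ k₂ + highPathCount i j k₁ ∎
    where
    N = suc (k₁ + k₂)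
    Row : ℕ → ℕ
    Row r = ∑[ s < suc (N ∸ r) ] indicator (accepts i j [] 0 0 (threeUpPath k₁ k₂ r s (N ∸ r ∸ s)))

Ctilde-threeUp-swap : ∀ k₁ k₂ i j → Ctilde (k₁ ∷ k₂ ∷ 0 ∷ []) i j ≡ Ctilde (k₁ ∷ k₂ ∷ 0 ∷ []) j i
Ctilde-threeUp-swap k₁ k₂ i j = begin
  Ctilde (k₁ ∷ k₂ ∷ 0 ∷ []) i j                       ≡⟨ Ctilde-threeUp i j k₁ k₂ ⟩
  lowPathCount i j k₁ k₂ + highPathCount i j k₁
    ≡⟨ cong₂ _+_ (lowPathCount-swap i j k₁ k₂) (highPathCount-swap i j k₁) ⟩
  lowPathCount j i k₁ k₂ + highPathCount j i k₁       ≡⟨ Ctilde-threeUp j i k₁ k₂ ⟨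
  Ctilde (k₁ ∷ k₂ ∷ 0 ∷ []) j i                       ∎

proposition4p6 :
    ((K : List ℕ) (a b : ℕ) (i j : ℕ) →
       Ctilde (K ++ [ a ]) i j ≡ Ctilde (K ++ [ b ]) i j)
    × ((K : List ℕ) → length K ≡ 3 → (i j : ℕ) →
       Ctilde K i j ≡ Ctilde K j i)
proposition4p6 = Ctilde-lastDegree-irrelevant , threeUp-symmetric
  where
  threeUp-symmetric : (K : List ℕ) → length K ≡ 3 → (i j : ℕ) → Ctilde K i j ≡ Ctilde K j i
  threeUp-symmetric (k₁ ∷ k₂ ∷ k₃ ∷ []) refl i j = begin
    Ctilde (k₁ ∷ k₂ ∷ k₃ ∷ []) i j    ≡⟨ Ctilde-lastDegree-irrelevant (k₁ ∷ k₂ ∷ []) k₃ 0 i j ⟩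
    Ctilde (k₁ ∷ k₂ ∷ 0 ∷ []) i j     ≡⟨ Ctilde-threeUp-swap k₁ k₂ i j ⟩
    Ctilde (k₁ ∷ k₂ ∷ 0 ∷ []) j i     ≡⟨ Ctilde-lastDegree-irrelevant (k₁ ∷ k₂ ∷ []) k₃ 0 j i ⟨
    Ctilde (k₁ ∷ k₂ ∷ k₃ ∷ []) j i    ∎
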